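{- Let $h$ be the morphism on $\{0,1,2\}^*$ defined by $h(0)=01$, $h(1)=21$, $h(2)=0$, and let $\mathbf{p}$ be the infinite fixed point of $h$ beginning with $0$. The nonempty palindromes occurring as factors of $\mathbf{p}$ are exactly $0,\ 1,\ 2,\ 121,\ 101,\ 010,\ 01210,\ 21012,\ 1012101$.
   Context: A palindrome is a word equal to its reversal. -}

module Defs where

open import Data.Nat using (ℕ; zero; suc; _+_)
open import Data.List using (List; []; _∷_; concatMap; map; reverse; length; upTo)
open import Data.Product using (∃)
open import Relation.Binary.PropositionalEquality using (_≡_)
open import Function using (_∘_)

data Letter : Set where
  𝟎 𝟏 𝟐 : Letter

Word : Set
Word = List Letter

hLetter : Letter → Word
hLetter 𝟎 = 𝟎 ∷ 𝟏 ∷ []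
hLetter 𝟏 = 𝟐 ∷ 𝟏 ∷ []
hLetter 𝟐 = 𝟎 ∷ []

h : Word → Word
h = concatMap hLetter

hIter : ℕ → Word → Word
hIter zero    w = w
hIter (suc n) w = h (hIter n w)

nthOr : Letter → Word → ℕ → Letter
nthOr d []       _       = d
nthOr d (x ∷ xs) zero    = x
nthOr d (x ∷ xs) (suc n) = nthOr d xs n

InfWord : Set
InfWord = ℕ → Letter

-- The infinite fixed point p = lim h^n(0) of h beginning with 0.
-- Since h(0) begins with 0, each h^n(0) is a prefix of h^(n+1)(0), and
-- |h^n(0)| ≥ n+1, so the i-th letter of p is the i-th letter of h^(i+1)(0)
-- (the default is never used).
p : InfWord
p i = nthOr 𝟎 (hIter (suc i) (𝟎 ∷ [])) i

Factor : Word → InfWord → Set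
Factor w x = ∃ λ i → w ≡ map (λ j → x (i + j)) (upTo (length w))

Palindrome : Word → Set
Palindrome w = w ≡ reverse w

claimedPalindromes : List Word
claimedPalindromes =
  (𝟎 ∷ []) ∷ (𝟏 ∷ []) ∷ (𝟐 ∷ []) ∷
  (𝟏 ∷ 𝟐 ∷ 𝟏 ∷ []) ∷ (𝟏 ∷ 𝟎 ∷ 𝟏 ∷ []) ∷ (𝟎 ∷ 𝟏 ∷ 𝟎 ∷ []) ∷
  (𝟎 ∷ 𝟏 ∷ 𝟐 ∷ 𝟏 ∷ 𝟎 ∷ []) ∷ (𝟐 ∷ 𝟏 ∷ 𝟎 ∷ 𝟏 ∷ 𝟐 ∷ []) ∷
  (𝟏 ∷ 𝟎 ∷ 𝟏 ∷ 𝟐 ∷ 𝟏 ∷ 𝟎 ∷ 𝟏 ∷ []) ∷ []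

-- The factors of length at most 10 of p are found by computation: the list of all windows of
-- length 10 of the approximants h^n(0) (together with the shorter windows at their right ends)
-- is closed under h, because h never erases a letter and so the first 10 letters of h(w) only
-- depend on the first 10 letters of w. Reading off their palindromic prefixes gives the list of
-- the statement; a longer palindromic factor would have a palindromic factor of length 9 or 10
-- at its centre, and there is none.
module Submission where

open import Defs
open import Data.Empty using (⊥-elim)
open import Data.List
  using (List; []; _∷_; _++_; _∷ʳ_; length; take; drop; reverse; upTo; applyUpTo; concatMap;
         inits; tails; map; initLast; _∷ʳ′_)
open import Data.List.Properties
  using (≡-dec; concatMap-++; ++-conicalˡ; ++-assoc; ++-identityʳ; length-++; length-drop;
         take-take; take++drop≡id; map-upTo; reverse-++; unfold-reverse; ∷-injectiveʳ;
         ∷ʳ-injectiveˡ)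
open import Data.List.Membership.Propositional using (_∈_)
open import Data.List.Membership.Propositional.Properties using (∈-map⁺)
open import Data.List.Relation.Unary.All as All using (All; []; _∷_; all?)
open import Data.List.Relation.Unary.Any using (here; there)
open import Data.Nat using (ℕ; zero; suc; _+_; _⊓_; _≤_; _<_; z≤n; s≤s; _≤?_)
open import Data.Nat.Properties
  using (≤-refl; ≤-trans; <-≤-trans; <⇒≤; <⇒≱; ≰⇒>; n≤1+n; m≤n⇒m⊓n≡m; m<m+n; +-comm;
         ≤-pred; m≤n+m; +-monoʳ-<; m+n≤o⇒m≤o∸n; module ≤-Reasoning)
open import Data.Product using (_×_; _,_; ∃; ∃₂)
open import Data.Unit using (⊤; tt)
open import Function using (_∘_)
open import Relation.Binary.Definitions using (DecidableEquality)
open import Relation.Binary.PropositionalEquality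
  using (_≡_; _≢_; refl; sym; trans; cong; cong₂; subst; module ≡-Reasoning)
open import Relation.Nullary using (Dec; yes; no; ¬_; ¬?)
open import Relation.Nullary.Decidable using (from-yes; _×-dec_; _→-dec_)

module _ {A : Set} where

  take-≤-cong : ∀ {m n} {v v′ : List A} → m ≤ n → take n v ≡ take n v′ → take m v ≡ take m v′
  take-≤-cong {m} {n} {v} {v′} m≤n eq = begin
    take m v            ≡⟨ cong (λ i → take i v) (m≤n⇒m⊓n≡m m≤n) ⟨
    take (m ⊓ n) v      ≡⟨ take-take m n v ⟨
    take m (take n v)   ≡⟨ cong (take m) eq ⟩
    take m (take n v′)  ≡⟨ take-take m n v′ ⟩
    take (m ⊓ n) v′     ≡⟨ cong (λ i → take i v′) (m≤n⇒m⊓n≡m m≤n) ⟩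
    take m v′           ∎
    where open ≡-Reasoning

  take-++-cong : ∀ n (u : List A) {v v′} → take n v ≡ take n v′ → take n (u ++ v) ≡ take n (u ++ v′)
  take-++-cong n       []      eq = eq
  take-++-cong zero    (x ∷ u) eq = refl
  take-++-cong (suc n) (x ∷ u) eq = cong (x ∷_) (take-++-cong n u (take-≤-cong (n≤1+n n) eq))

  take-suc-++-cong : ∀ n (u : List A) {v v′} → u ≢ [] → take n v ≡ take n v′ →
                     take (suc n) (u ++ v) ≡ take (suc n) (u ++ v′)
  take-suc-++-cong n []      u≢[] eq = ⊥-elim (u≢[] refl)
  take-suc-++-cong n (x ∷ u) u≢[] eq = cong (x ∷_) (take-++-cong n u eq)

  ∈-tails-++ : ∀ (u s : List A) → s ∈ tails (u ++ s)
  ∈-tails-++ []      s = here refl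
  ∈-tails-++ (x ∷ u) s = there (∈-tails-++ u s)

  ∈-inits-take : ∀ n (w v : List A) → length w ≤ n → w ∈ inits (take n (w ++ v))
  ∈-inits-take n       []      v _           = here refl
  ∈-inits-take (suc n) (x ∷ w) v (s≤s |w|≤n) = there (∈-map⁺ (x ∷_) (∈-inits-take n w v |w|≤n))

  suffixes⁺ : List A → List (List A)
  suffixes⁺ []      = []
  suffixes⁺ (x ∷ u) = (x ∷ u) ∷ suffixes⁺ u

module _ {A B : Set} (f : A → List B) (f-nonErasing : ∀ a → f a ≢ []) where

  take-concatMap : ∀ n w → take n (concatMap f w) ≡ take n (concatMap f (take n w))
  take-concatMap zero    w       = refl
  take-concatMap (suc n) []      = refl
  take-concatMap (suc n) (a ∷ w) = take-suc-++-cong n (f a) (f-nonErasing a) (take-concatMap n w)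

  concatMap-≢[] : ∀ {w} → w ≢ [] → concatMap f w ≢ []
  concatMap-≢[] {[]}    w≢[] = ⊥-elim (w≢[] refl)
  concatMap-≢[] {a ∷ w} _    = f-nonErasing a ∘ ++-conicalˡ (f a) (concatMap f w)

-- Windows w lists take (suc k) of every suffix of w, so the windows starting in the last k
-- letters are shorter, down to the empty one.
module WindowsUnder {A : Set} (f : A → List A) (f-nonErasing : ∀ a → f a ≢ [])
                    (k : ℕ) (S : List (List A)) where

  Windows : List A → Set
  Windows w = All (λ s → take (suc k) s ∈ S) (tails w)

  -- For the window a w′ of a w: the windows of f(a w) starting inside f(a) lie in S. They depend
  -- only on a w′ because f is non-erasing.
  ClosedAt : List A → Set
  ClosedAt []       = ⊤
  ClosedAt (a ∷ w′) = All (λ s → take (suc k) (s ++ concatMap f w′) ∈ S) (suffixes⁺ (f a))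

  windows-++ : ∀ u {v v′} → take k v ≡ take k v′ →
               All (λ s → take (suc k) (s ++ v′) ∈ S) (suffixes⁺ u) → Windows v → Windows (u ++ v)
  windows-++ []      eq []         wv = wv
  windows-++ (x ∷ u) eq (px ∷ pu) wv =
    subst (_∈ S) (sym (take-suc-++-cong k (x ∷ u) (λ ()) eq)) px ∷ windows-++ u eq pu wv

  windows-concatMap : All ClosedAt S → ∀ w → Windows w → Windows (concatMap f w)
  windows-concatMap closed []      ws         = ws
  windows-concatMap closed (a ∷ w) (t∈S ∷ ws) =
    windows-++ (f a) (take-concatMap f f-nonErasing k w) (All.lookup closed t∈S)
               (windows-concatMap closed w ws)

  prefix-of-window : ∀ {P : List A → Set} → All (λ t → All P (inits t)) S →
                     ∀ u w v → Windows (u ++ w ++ v) → length w ≤ suc k → P w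
  prefix-of-window prefixes u w v ws |w|≤ =
    All.lookup (All.lookup prefixes (All.lookup ws (∈-tails-++ u (w ++ v))))
               (∈-inits-take (suc k) w v |w|≤)

hLetter-nonErasing : ∀ a → hLetter a ≢ []
hLetter-nonErasing 𝟎 ()
hLetter-nonErasing 𝟏 ()
hLetter-nonErasing 𝟐 ()

approx : ℕ → Word
approx n = hIter n (𝟎 ∷ [])

approx-suc : ∀ n → approx (suc n) ≡ approx n ++ hIter n (𝟏 ∷ [])
approx-suc zero    = refl
approx-suc (suc n) = trans (cong h (approx-suc n)) (concatMap-++ hLetter (approx n) _)

approx-prefix : ∀ k n → ∃ λ R → approx (k + n) ≡ approx n ++ R
approx-prefix zero    n = [] , sym (++-identityʳ (approx n))
approx-prefix (suc k) n with R , eq ← approx-prefix k n =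
  R ++ hIter (k + n) (𝟏 ∷ []) ,
  trans (approx-suc (k + n)) (trans (cong (_++ _) eq) (++-assoc (approx n) R _))

hIter-≢[] : ∀ n {w} → w ≢ [] → hIter n w ≢ []
hIter-≢[] zero    w≢[] = w≢[]
hIter-≢[] (suc n) w≢[] = concatMap-≢[] hLetter hLetter-nonErasing (hIter-≢[] n w≢[])

length-approx : ∀ n → n < length (approx n)
length-approx zero    = s≤s z≤n
length-approx (suc n) = begin-strict
  suc n                                          ≤⟨ length-approx n ⟩
  length (approx n)                              <⟨ m<m+n _ (nonempty-length (hIter-≢[] n (λ ()))) ⟩
  length (approx n) + length (hIter n (𝟏 ∷ []))  ≡⟨ length-++ (approx n) ⟨
  length (approx n ++ hIter n (𝟏 ∷ []))          ≡⟨ cong length (approx-suc n) ⟨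
  length (approx (suc n))                        ∎
  where
  open ≤-Reasoning
  nonempty-length : ∀ {w : Word} → w ≢ [] → 0 < length w
  nonempty-length {[]}    w≢[] = ⊥-elim (w≢[] refl)
  nonempty-length {_ ∷ _} _    = s≤s z≤n

nthOr-++ : ∀ {d} u {v} {j} → j < length u → nthOr d (u ++ v) j ≡ nthOr d u j
nthOr-++ (x ∷ u) {j = zero}  _            = refl
nthOr-++ (x ∷ u) {j = suc j} (s≤s j<|u|) = nthOr-++ u j<|u|

nthOr-drop : ∀ {d} i V j → nthOr d (drop i V) j ≡ nthOr d V (i + j)
nthOr-drop zero    V       j = refl
nthOr-drop (suc i) []      j = refl
nthOr-drop (suc i) (x ∷ V) j = nthOr-drop i V j

applyUpTo-nthOr : ∀ {d} {f : ℕ → Letter} V n → n ≤ length V →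
                  (∀ j → j < n → f j ≡ nthOr d V j) → applyUpTo f n ≡ take n V
applyUpTo-nthOr V       zero    _           _  = refl
applyUpTo-nthOr (x ∷ V) (suc n) (s≤s n≤|V|) eq =
  cong₂ _∷_ (eq 0 (s≤s z≤n)) (applyUpTo-nthOr V n n≤|V| (λ j j<n → eq (suc j) (s≤s j<n)))

-- p i is defined through approx (suc i); both that and approx N are prefixes of approx (N + suc i).
p-approx : ∀ N {i} → i < length (approx N) → p i ≡ nthOr 𝟎 (approx N) i
p-approx N {i} i-in-range
  with R₁ , e₁ ← approx-prefix N (suc i) | R₂ , e₂ ← approx-prefix (suc i) N = begin
  nthOr 𝟎 (approx (suc i)) i       ≡⟨ nthOr-++ (approx (suc i)) (<⇒≤ (length-approx (suc i))) ⟨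
  nthOr 𝟎 (approx (suc i) ++ R₁) i ≡⟨ cong (λ V → nthOr 𝟎 V i) e₁ ⟨
  nthOr 𝟎 (approx (N + suc i)) i   ≡⟨ cong (λ n → nthOr 𝟎 (approx n) i) (+-comm N (suc i)) ⟩
  nthOr 𝟎 (approx (suc i + N)) i   ≡⟨ cong (λ V → nthOr 𝟎 V i) e₂ ⟩
  nthOr 𝟎 (approx N ++ R₂) i       ≡⟨ nthOr-++ (approx N) i-in-range ⟩
  nthOr 𝟎 (approx N) i             ∎
  where open ≡-Reasoning

factor-occurs-in-approx : ∀ {w} → Factor w p → ∃ λ N → ∃₂ λ u v → approx N ≡ u ++ w ++ v
factor-occurs-in-approx {w} (i , w≡) = N , take i V , drop n D , V≡
  where
  n = length w
  N = i + n
  V = approx N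
  D = drop i V
  i+n≤|V| : i + n ≤ length V
  i+n≤|V| = <⇒≤ (length-approx N)
  n≤|D| : n ≤ length D
  n≤|D| = subst (n ≤_) (sym (length-drop i V))
            (m+n≤o⇒m≤o∸n n (subst (_≤ length V) (+-comm i n) i+n≤|V|))
  w≡D : w ≡ take n D
  w≡D = begin
    w                               ≡⟨ w≡ ⟩
    map (λ j → p (i + j)) (upTo n)  ≡⟨ map-upTo (λ j → p (i + j)) n ⟩
    applyUpTo (λ j → p (i + j)) n   ≡⟨ applyUpTo-nthOr D n n≤|D| (λ j j<n →
      trans (p-approx N (<-≤-trans (+-monoʳ-< i j<n) i+n≤|V|)) (sym (nthOr-drop i V j))) ⟩
    take n D                        ∎
    where open ≡-Reasoning
  V≡ : V ≡ take i V ++ w ++ drop n D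
  V≡ = begin
    V                                ≡⟨ take++drop≡id i V ⟨
    take i V ++ D                    ≡⟨ cong (take i V ++_) (take++drop≡id n D) ⟨
    take i V ++ take n D ++ drop n D ≡⟨ cong (λ x → take i V ++ x ++ drop n D) w≡D ⟨
    take i V ++ w ++ drop n D        ∎
    where open ≡-Reasoning

_≟ᴸ_ : DecidableEquality Letter
𝟎 ≟ᴸ 𝟎 = yes refl
𝟎 ≟ᴸ 𝟏 = no λ ()
𝟎 ≟ᴸ 𝟐 = no λ ()
𝟏 ≟ᴸ 𝟎 = no λ ()
𝟏 ≟ᴸ 𝟏 = yes refl
𝟏 ≟ᴸ 𝟐 = no λ ()
𝟐 ≟ᴸ 𝟎 = no λ ()
𝟐 ≟ᴸ 𝟏 = no λ ()
𝟐 ≟ᴸ 𝟐 = yes refl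

_≟_ : DecidableEquality Word
_≟_ = ≡-dec _≟ᴸ_

open import Data.List.Membership.DecPropositional _≟_ using (_∈?_)

-- The windows of length 10 of all approximants, and the shorter ones at their right ends.
windows₁₀ : List Word
windows₁₀ =
  [] ∷
  (𝟎 ∷ []) ∷
  (𝟏 ∷ []) ∷
  (𝟎 ∷ 𝟏 ∷ []) ∷
  (𝟐 ∷ 𝟏 ∷ []) ∷
  (𝟎 ∷ 𝟐 ∷ 𝟏 ∷ []) ∷
  (𝟏 ∷ 𝟐 ∷ 𝟏 ∷ []) ∷
  (𝟎 ∷ 𝟏 ∷ 𝟐 ∷ 𝟏 ∷ []) ∷
  (𝟏 ∷ 𝟎 ∷ 𝟐 ∷ 𝟏 ∷ []) ∷
  (𝟎 ∷ 𝟏 ∷ 𝟎 ∷ 𝟐 ∷ 𝟏 ∷ []) ∷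
  (𝟐 ∷ 𝟏 ∷ 𝟎 ∷ 𝟐 ∷ 𝟏 ∷ []) ∷
  (𝟏 ∷ 𝟎 ∷ 𝟏 ∷ 𝟎 ∷ 𝟐 ∷ 𝟏 ∷ []) ∷
  (𝟏 ∷ 𝟐 ∷ 𝟏 ∷ 𝟎 ∷ 𝟐 ∷ 𝟏 ∷ []) ∷
  (𝟎 ∷ 𝟏 ∷ 𝟐 ∷ 𝟏 ∷ 𝟎 ∷ 𝟐 ∷ 𝟏 ∷ []) ∷
  (𝟐 ∷ 𝟏 ∷ 𝟎 ∷ 𝟏 ∷ 𝟎 ∷ 𝟐 ∷ 𝟏 ∷ []) ∷
  (𝟎 ∷ 𝟐 ∷ 𝟏 ∷ 𝟎 ∷ 𝟏 ∷ 𝟎 ∷ 𝟐 ∷ 𝟏 ∷ []) ∷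
  (𝟏 ∷ 𝟐 ∷ 𝟏 ∷ 𝟎 ∷ 𝟏 ∷ 𝟎 ∷ 𝟐 ∷ 𝟏 ∷ []) ∷
  (𝟎 ∷ 𝟏 ∷ 𝟐 ∷ 𝟏 ∷ 𝟎 ∷ 𝟏 ∷ 𝟎 ∷ 𝟐 ∷ 𝟏 ∷ []) ∷
  (𝟏 ∷ 𝟎 ∷ 𝟐 ∷ 𝟏 ∷ 𝟎 ∷ 𝟏 ∷ 𝟎 ∷ 𝟐 ∷ 𝟏 ∷ []) ∷
  (𝟎 ∷ 𝟏 ∷ 𝟎 ∷ 𝟐 ∷ 𝟏 ∷ 𝟎 ∷ 𝟏 ∷ 𝟐 ∷ 𝟏 ∷ 𝟎 ∷ []) ∷
  (𝟎 ∷ 𝟏 ∷ 𝟐 ∷ 𝟏 ∷ 𝟎 ∷ 𝟏 ∷ 𝟎 ∷ 𝟐 ∷ 𝟏 ∷ 𝟎 ∷ []) ∷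
  (𝟎 ∷ 𝟏 ∷ 𝟐 ∷ 𝟏 ∷ 𝟎 ∷ 𝟐 ∷ 𝟏 ∷ 𝟎 ∷ 𝟏 ∷ 𝟎 ∷ []) ∷
  (𝟎 ∷ 𝟏 ∷ 𝟐 ∷ 𝟏 ∷ 𝟎 ∷ 𝟐 ∷ 𝟏 ∷ 𝟎 ∷ 𝟏 ∷ 𝟐 ∷ []) ∷
  (𝟎 ∷ 𝟐 ∷ 𝟏 ∷ 𝟎 ∷ 𝟏 ∷ 𝟎 ∷ 𝟐 ∷ 𝟏 ∷ 𝟎 ∷ 𝟏 ∷ []) ∷
  (𝟎 ∷ 𝟐 ∷ 𝟏 ∷ 𝟎 ∷ 𝟏 ∷ 𝟐 ∷ 𝟏 ∷ 𝟎 ∷ 𝟏 ∷ 𝟎 ∷ []) ∷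
  (𝟎 ∷ 𝟐 ∷ 𝟏 ∷ 𝟎 ∷ 𝟏 ∷ 𝟐 ∷ 𝟏 ∷ 𝟎 ∷ 𝟐 ∷ 𝟏 ∷ []) ∷
  (𝟏 ∷ 𝟎 ∷ 𝟏 ∷ 𝟎 ∷ 𝟐 ∷ 𝟏 ∷ 𝟎 ∷ 𝟏 ∷ 𝟐 ∷ 𝟏 ∷ []) ∷
  (𝟏 ∷ 𝟎 ∷ 𝟏 ∷ 𝟐 ∷ 𝟏 ∷ 𝟎 ∷ 𝟏 ∷ 𝟎 ∷ 𝟐 ∷ 𝟏 ∷ []) ∷
  (𝟏 ∷ 𝟎 ∷ 𝟏 ∷ 𝟐 ∷ 𝟏 ∷ 𝟎 ∷ 𝟐 ∷ 𝟏 ∷ 𝟎 ∷ 𝟏 ∷ []) ∷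
  (𝟏 ∷ 𝟎 ∷ 𝟐 ∷ 𝟏 ∷ 𝟎 ∷ 𝟏 ∷ 𝟎 ∷ 𝟐 ∷ 𝟏 ∷ 𝟎 ∷ []) ∷
  (𝟏 ∷ 𝟎 ∷ 𝟐 ∷ 𝟏 ∷ 𝟎 ∷ 𝟏 ∷ 𝟐 ∷ 𝟏 ∷ 𝟎 ∷ 𝟏 ∷ []) ∷
  (𝟏 ∷ 𝟎 ∷ 𝟐 ∷ 𝟏 ∷ 𝟎 ∷ 𝟏 ∷ 𝟐 ∷ 𝟏 ∷ 𝟎 ∷ 𝟐 ∷ []) ∷
  (𝟏 ∷ 𝟐 ∷ 𝟏 ∷ 𝟎 ∷ 𝟏 ∷ 𝟎 ∷ 𝟐 ∷ 𝟏 ∷ 𝟎 ∷ 𝟏 ∷ []) ∷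
  (𝟏 ∷ 𝟐 ∷ 𝟏 ∷ 𝟎 ∷ 𝟐 ∷ 𝟏 ∷ 𝟎 ∷ 𝟏 ∷ 𝟎 ∷ 𝟐 ∷ []) ∷
  (𝟏 ∷ 𝟐 ∷ 𝟏 ∷ 𝟎 ∷ 𝟐 ∷ 𝟏 ∷ 𝟎 ∷ 𝟏 ∷ 𝟐 ∷ 𝟏 ∷ []) ∷
  (𝟐 ∷ 𝟏 ∷ 𝟎 ∷ 𝟏 ∷ 𝟎 ∷ 𝟐 ∷ 𝟏 ∷ 𝟎 ∷ 𝟏 ∷ 𝟐 ∷ []) ∷
  (𝟐 ∷ 𝟏 ∷ 𝟎 ∷ 𝟏 ∷ 𝟐 ∷ 𝟏 ∷ 𝟎 ∷ 𝟏 ∷ 𝟎 ∷ 𝟐 ∷ []) ∷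
  (𝟐 ∷ 𝟏 ∷ 𝟎 ∷ 𝟏 ∷ 𝟐 ∷ 𝟏 ∷ 𝟎 ∷ 𝟐 ∷ 𝟏 ∷ 𝟎 ∷ []) ∷
  (𝟐 ∷ 𝟏 ∷ 𝟎 ∷ 𝟐 ∷ 𝟏 ∷ 𝟎 ∷ 𝟏 ∷ 𝟎 ∷ 𝟐 ∷ 𝟏 ∷ []) ∷
  (𝟐 ∷ 𝟏 ∷ 𝟎 ∷ 𝟐 ∷ 𝟏 ∷ 𝟎 ∷ 𝟏 ∷ 𝟐 ∷ 𝟏 ∷ 𝟎 ∷ []) ∷ []

open WindowsUnder hLetter hLetter-nonErasing 9 windows₁₀

windows₁₀-closed : All ClosedAt windows₁₀
windows₁₀-closed = from-yes (all? closedAt? windows₁₀)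
  where
  closedAt? : ∀ t → Dec (ClosedAt t)
  closedAt? []      = yes tt
  closedAt? (a ∷ r) = all? (λ s → take 10 (s ++ h r) ∈? windows₁₀) (suffixes⁺ (hLetter a))

windows-approx : ∀ n → Windows (approx n)
windows-approx zero    = from-yes (all? (λ s → take 10 s ∈? windows₁₀) (tails (𝟎 ∷ [])))
windows-approx (suc n) = windows-concatMap windows₁₀-closed (approx n) (windows-approx n)

ListedIfPalindrome : Word → Set
ListedIfPalindrome w = w ≢ [] → Palindrome w → w ∈ claimedPalindromes

windows₁₀-palindromic-prefixes : All (λ t → All ListedIfPalindrome (inits t)) windows₁₀
windows₁₀-palindromic-prefixes = from-yes (all? (λ t → all? listed? (inits t)) windows₁₀)
  where
  listed? : ∀ w → Dec (ListedIfPalindrome w)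
  listed? w = ¬? (w ≟ []) →-dec (w ≟ reverse w →-dec w ∈? claimedPalindromes)

claimed-length : All (λ w → length w ≤ 7) claimedPalindromes
claimed-length = from-yes (all? (λ w → length w ≤? 7) claimedPalindromes)

claimed-nonempty-palindromes : All (λ w → w ≢ [] × Palindrome w) claimedPalindromes
claimed-nonempty-palindromes = from-yes (all? (λ w → ¬? (w ≟ []) ×-dec w ≟ reverse w) claimedPalindromes)

claimed-factors : All (λ w → Factor w p) claimedPalindromes
claimed-factors =
  (0 , refl) ∷ (1 , refl) ∷ (2 , refl) ∷ (1 , refl) ∷ (6 , refl) ∷ (7 , refl) ∷
  (0 , refl) ∷ (10 , refl) ∷ (11 , refl) ∷ []

data Stripped : Word → Set where
  outer : ∀ a m b → Stripped (a ∷ m ∷ʳ b)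

strip : ∀ w → 2 ≤ length w → Stripped w
strip (a ∷ w′) 2≤ with initLast w′
strip (a ∷ .[])       (s≤s ()) | []
strip (a ∷ .(m ∷ʳ b)) _        | m ∷ʳ′ b = outer a m b

length-strip : ∀ (a : Letter) m b → length (a ∷ m ∷ʳ b) ≡ suc (suc (length m))
length-strip a m b = cong suc (trans (length-++ m) (+-comm (length m) 1))

palindrome-strip : ∀ (a : Letter) m b → Palindrome (a ∷ m ∷ʳ b) → Palindrome m
palindrome-strip a m b pal = ∷ʳ-injectiveˡ m (reverse m) (∷-injectiveʳ (begin
  a ∷ m ∷ʳ b               ≡⟨ pal ⟩
  reverse (a ∷ m ∷ʳ b)     ≡⟨ unfold-reverse a (m ∷ʳ b) ⟩
  reverse (m ∷ʳ b) ∷ʳ a    ≡⟨ cong (_∷ʳ a) (reverse-++ m (b ∷ [])) ⟩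
  b ∷ reverse m ∷ʳ a       ∎))
  where open ≡-Reasoning

occurrence-strip : ∀ u (a : Letter) m b v → u ++ (a ∷ m ∷ʳ b) ++ v ≡ (u ∷ʳ a) ++ m ++ b ∷ v
occurrence-strip u a m b v = begin
  u ++ (a ∷ m ∷ʳ b) ++ v     ≡⟨ cong (u ++_) (cong (a ∷_) (++-assoc m (b ∷ []) v)) ⟩
  u ++ a ∷ m ++ b ∷ v        ≡⟨ ++-assoc u (a ∷ []) (m ++ b ∷ v) ⟨
  (u ∷ʳ a) ++ m ++ b ∷ v     ∎
  where open ≡-Reasoning

short-palindrome-listed : ∀ u w v → Windows (u ++ w ++ v) → length w ≤ 10 → ListedIfPalindrome w
short-palindrome-listed = prefix-of-window windows₁₀-palindromic-prefixes

-- Palindromic factors of length 8 to 10 are excluded by the finite check; stripping both ends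
-- of a longer palindrome leaves a palindromic factor of length at least 9.
no-long-palindrome : ∀ n u w v → Windows (u ++ w ++ v) → length w ≤ n → 7 < length w → ¬ Palindrome w
no-long-palindrome zero    u w v ws bound long pal = <⇒≱ long (≤-trans bound z≤n)
no-long-palindrome (suc n) u w v ws bound long pal with length w ≤? 10
... | yes short = <⇒≱ long (All.lookup claimed-length
                    (short-palindrome-listed u w v ws short (λ { refl → <⇒≱ long z≤n }) pal))
... | no notShort with strip w (≤-trans (s≤s (s≤s z≤n)) (≰⇒> notShort))
...   | outer a m b rewrite length-strip a m b =
  no-long-palindrome n (u ∷ʳ a) m (b ∷ v) (subst Windows (occurrence-strip u a m b v) ws)
    (<⇒≤ (≤-pred bound)) (<⇒≤ (≤-pred (≤-pred (≰⇒> notShort))))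
    (palindrome-strip a m b pal)

palindromic-factor-listed : ∀ u w v → Windows (u ++ w ++ v) → ListedIfPalindrome w
palindromic-factor-listed u w v ws w≢[] pal with length w ≤? 7
... | yes |w|≤7 = short-palindrome-listed u w v ws (≤-trans |w|≤7 (m≤n+m 7 3)) w≢[] pal
... | no long   = ⊥-elim (no-long-palindrome (length w) u w v ws ≤-refl (≰⇒> long) pal)

theorem6 : (w : Word) →
    ((w ≢ [] × Palindrome w × Factor w p) → w ∈ claimedPalindromes)
      × (w ∈ claimedPalindromes → (w ≢ [] × Palindrome w × Factor w p))
theorem6 w = forward , backward
  where
  forward : w ≢ [] × Palindrome w × Factor w p → w ∈ claimedPalindromes
  forward (w≢[] , pal , w-factor) with N , u , v , approxN≡ ← factor-occurs-in-approx w-factor =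
    palindromic-factor-listed u w v (subst Windows approxN≡ (windows-approx N)) w≢[] pal

  backward : w ∈ claimedPalindromes → w ≢ [] × Palindrome w × Factor w p
  backward w∈ with w≢[] , pal ← All.lookup claimed-nonempty-palindromes w∈ =
    w≢[] , pal , All.lookup claimed-factors w∈
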